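{- For every integer $n\ge 1$, $v_n\equiv 0\pmod{(2n-3)^3}$.
   Context: For an integer $n\ge 1$ let $v_n=\Big[(1-x)\prod_{j=0}^{2n-3}(2n-3-j+jx)\Big]_{x^{n-1}}$, where $[f(x)]_{x^m}$ denotes the coefficient of $x^m$ in $f$ (an empty product equals $1$). -}

module Defs where

open import Data.Nat using (ℕ; zero; suc; _∸_)
import Data.Nat as N
open import Data.Integer using (ℤ; +_; -_; _-_; _+_; _*_)
open import Data.List using (List; []; _∷_)

-- Polynomials in x with integer coefficients, as coefficient lists
-- (constant term first).
Poly : Set
Poly = List ℤ

_⊕_ : Poly → Poly → Poly
[]       ⊕ q        = q
p        ⊕ []       = p
(a ∷ p)  ⊕ (b ∷ q)  = (a + b) ∷ (p ⊕ q)

_·_ : ℤ → Poly → Poly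
c · []      = []
c · (a ∷ p) = (c * a) ∷ (c · p)

mulLin : ℤ → ℤ → Poly → Poly
mulLin c₀ c₁ p = (c₀ · p) ⊕ (+ 0 ∷ (c₁ · p))

coeff : Poly → ℕ → ℤ
coeff []      _       = + 0
coeff (a ∷ p) zero    = a
coeff (a ∷ p) (suc m) = coeff p m

-- linProd a k = ∏_{j=0}^{k-1} ((a - j) + j x)   (empty product = 1)
linProd : ℤ → ℕ → Poly
linProd a zero    = + 1 ∷ []
linProd a (suc k) = mulLin (a - + k) (+ k) (linProd a k)

-- v n = [ (1 - x) ∏_{j=0}^{2n-3} ((2n-3-j) + j x) ]_{x^{n-1}}
-- The product has 2n-2 factors (empty when n = 1).
v : ℕ → ℤ
v n = coeff (mulLin (+ 1) (- + 1) (linProd (+ (2 N.* n) - + 3) ((2 N.* n) ∸ 2))) (n ∸ 1)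

{-# OPTIONS --safe #-}
module Submission where

-- Write a = 2n - 3 and P = ∏_{j=0}^{a} (a - j + j x).  The factor j = 0 is
-- a, the factor j = a is a x, and every other factor is ≡ j (x - 1) modulo a;
-- hence P ≡ a² (a - 1)! x (x - 1)^(a - 1) modulo a³, and the coefficient of
-- x^(n-1) in (1 - x) P is ≡ -a² (a - 1)! [(x - 1)^a]_{x^(n-2)} modulo a³.
-- For n ≥ 3 this is divisible by a³ because a ∣ (a - 1)! (a choose i) for
-- 0 < i < a: i (a choose i) = a (a - 1 choose i - 1) and i ∣ (a - 1)!.
-- For n ≤ 2 there is nothing to prove, as |a| = 1.

open import Defs
open import Data.Nat using (ℕ; _≤_; zero; suc; _!; s≤s; z≤n)
import Data.Nat as N
open import Data.Integer using (ℤ; +_; _-_; _^_; _+_; _*_; -_)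
open import Data.Integer.Divisibility using (_∣_)
import Data.Nat.Properties as ℕ
import Data.Nat.Divisibility as ℕ
import Data.Nat.Tactic.RingSolver as ℕ-Solver
open import Data.Integer.Properties using (+-identityˡ; +-identityʳ; *-zeroʳ; *-assoc; *-identityʳ; pos-*)
open import Data.Integer.Divisibility.Signed as Signed
  using (divides; ∣⇒∣ᵤ; ∣-refl; ∣m∣n⇒∣m+n; ∣m∣n⇒∣m-n; ∣m⇒∣-m; ∣n⇒∣m*n; ∣m⇒∣m*n; *-monoʳ-∣)
open import Data.Integer.Tactic.RingSolver using (solve-∀)
open import Data.List using ([]; _∷_)
open import Relation.Binary.PropositionalEquality
open ≡-Reasoning

coeff-⊕ : ∀ p q i → coeff (p ⊕ q) i ≡ coeff p i + coeff q i
coeff-⊕ []      q       i       = sym (+-identityˡ (coeff q i))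
coeff-⊕ (a ∷ p) []      i       = sym (+-identityʳ (coeff (a ∷ p) i))
coeff-⊕ (a ∷ p) (b ∷ q) zero    = refl
coeff-⊕ (a ∷ p) (b ∷ q) (suc i) = coeff-⊕ p q i

coeff-· : ∀ c p i → coeff (c · p) i ≡ c * coeff p i
coeff-· c []      i       = sym (*-zeroʳ c)
coeff-· c (a ∷ p) zero    = refl
coeff-· c (a ∷ p) (suc i) = coeff-· c p i

coeff-mulLin-zero : ∀ c₀ c₁ p → coeff (mulLin c₀ c₁ p) 0 ≡ c₀ * coeff p 0
coeff-mulLin-zero c₀ c₁ p = begin
  coeff ((c₀ · p) ⊕ (+ 0 ∷ (c₁ · p))) 0 ≡⟨ coeff-⊕ (c₀ · p) (+ 0 ∷ (c₁ · p)) 0 ⟩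
  coeff (c₀ · p) 0 + + 0                ≡⟨ +-identityʳ _ ⟩
  coeff (c₀ · p) 0                      ≡⟨ coeff-· c₀ p 0 ⟩
  c₀ * coeff p 0                        ∎

coeff-mulLin-suc : ∀ c₀ c₁ p i →
  coeff (mulLin c₀ c₁ p) (suc i) ≡ c₀ * coeff p (suc i) + c₁ * coeff p i
coeff-mulLin-suc c₀ c₁ p i = begin
  coeff ((c₀ · p) ⊕ (+ 0 ∷ (c₁ · p))) (suc i) ≡⟨ coeff-⊕ (c₀ · p) (+ 0 ∷ (c₁ · p)) (suc i) ⟩
  coeff (c₀ · p) (suc i) + coeff (c₁ · p) i   ≡⟨ cong₂ _+_ (coeff-· c₀ p (suc i)) (coeff-· c₁ p i) ⟩
  c₀ * coeff p (suc i) + c₁ * coeff p i       ∎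

-- signedBinomial k i = [(x - 1)^k]_{x^i} = (-1)^(k - i) (k choose i)
signedBinomial : ℕ → ℕ → ℤ
signedBinomial zero    zero    = + 1
signedBinomial zero    (suc i) = + 0
signedBinomial (suc k) zero    = - signedBinomial k zero
signedBinomial (suc k) (suc i) = signedBinomial k i - signedBinomial k (suc i)

signedBinomial-absorption : ∀ k i →
  + suc i * signedBinomial (suc k) (suc i) ≡ + suc k * signedBinomial k i
signedBinomial-absorption zero    zero    = refl
signedBinomial-absorption zero    (suc i) = identity (+ suc (suc i))
  where
  identity : ∀ m → m * (+ 0 - + 0) ≡ + 1 * + 0
  identity = solve-∀
signedBinomial-absorption (suc k) zero    = begin
  + 1 * (- s₀ - s₁)          ≡⟨ identity₁ s₀ s₁ ⟩
  - s₀ - + 1 * s₁            ≡⟨ cong (λ t → - s₀ - t) (signedBinomial-absorption k zero) ⟩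
  - s₀ - + suc k * s₀        ≡⟨ identity₂ (+ suc k) s₀ ⟩
  + suc (suc k) * (- s₀)     ∎
  where
  s₀ = signedBinomial k 0
  s₁ = signedBinomial (suc k) 1
  identity₁ : ∀ x y → + 1 * (- x - y) ≡ - x - + 1 * y
  identity₁ = solve-∀
  identity₂ : ∀ m x → - x - m * x ≡ (+ 1 + m) * (- x)
  identity₂ = solve-∀
signedBinomial-absorption (suc k) (suc i) = begin
  + suc (suc i) * ((sᵢ - sᵢ₊₁) - t)               ≡⟨ identity₁ (+ suc i) sᵢ sᵢ₊₁ t ⟩
  + suc i * (sᵢ - sᵢ₊₁) + (sᵢ - sᵢ₊₁) - + suc (suc i) * t
    ≡⟨ cong₂ (λ x y → x + (sᵢ - sᵢ₊₁) - y)
             (signedBinomial-absorption k i) (signedBinomial-absorption k (suc i)) ⟩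
  + suc k * sᵢ + (sᵢ - sᵢ₊₁) - + suc k * sᵢ₊₁      ≡⟨ identity₂ (+ suc k) sᵢ sᵢ₊₁ ⟩
  + suc (suc k) * (sᵢ - sᵢ₊₁)                      ∎
  where
  sᵢ   = signedBinomial k i
  sᵢ₊₁ = signedBinomial k (suc i)
  t    = signedBinomial (suc k) (suc (suc i))
  identity₁ : ∀ m x y z → (+ 1 + m) * ((x - y) - z) ≡ m * (x - y) + (x - y) - (+ 1 + m) * z
  identity₁ = solve-∀
  identity₂ : ∀ m x y → m * x + (x - y) - m * y ≡ (+ 1 + m) * (x - y)
  identity₂ = solve-∀

[1+k]∣k!*signedBinomial[1+k] : ∀ k i → i N.< k →
  + suc k Signed.∣ + (k !) * signedBinomial (suc k) (suc i)
[1+k]∣k!*signedBinomial[1+k] k i i<k with ℕ.∣-trans (ℕ.m∣m*n (i !)) (ℕ.m≤n⇒m!∣n! i<k)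
... | ℕ.divides r k!≡r*[1+i] = divides (+ r * sᵢ) (begin
  + (k !) * s                ≡⟨ cong (λ m → + m * s) k!≡r*[1+i] ⟩
  + (r N.* suc i) * s        ≡⟨ cong (_* s) (pos-* r (suc i)) ⟩
  + r * + suc i * s          ≡⟨ *-assoc (+ r) (+ suc i) s ⟩
  + r * (+ suc i * s)        ≡⟨ cong (+ r *_) (signedBinomial-absorption k i) ⟩
  + r * (+ suc k * sᵢ)       ≡⟨ identity (+ r) (+ suc k) sᵢ ⟩
  + r * sᵢ * + suc k         ∎)
  where
  s  = signedBinomial (suc k) (suc i)
  sᵢ = signedBinomial k i
  identity : ∀ x y z → x * (y * z) ≡ x * z * y
  identity = solve-∀

a*a∣linProd-a*k!*signedBinomial : ∀ a k i →
  a * a Signed.∣ coeff (linProd a (suc k)) i - a * (+ (k !) * signedBinomial k i)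
a*a∣linProd-a*k!*signedBinomial a zero zero    = divides (+ 0) (identity a)
  where
  identity : ∀ a → (a - + 0) * + 1 + + 0 - a * (+ 1 * + 1) ≡ + 0 * (a * a)
  identity = solve-∀
a*a∣linProd-a*k!*signedBinomial a zero (suc i) = divides (+ 0) (begin
  coeff (linProd a 1) (suc i) - a * (+ 1 * + 0)
    ≡⟨ cong (_- a * (+ 1 * + 0)) (coeff-mulLin-suc (a - + 0) (+ 0) (+ 1 ∷ []) i) ⟩
  (a - + 0) * + 0 + + 0 * coeff (+ 1 ∷ []) i - a * (+ 1 * + 0)
    ≡⟨ identity a (coeff (+ 1 ∷ []) i) ⟩
  + 0 * (a * a) ∎)
  where
  identity : ∀ a x → (a - + 0) * + 0 + + 0 * x - a * (+ 1 * + 0) ≡ + 0 * (a * a)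
  identity = solve-∀
a*a∣linProd-a*k!*signedBinomial a (suc k) zero    = subst (a * a Signed.∣_) (begin
  (a - K) * (c₀ - a * (F * s₀)) + a * a * (F * s₀)
    ≡⟨ identity a K F c₀ s₀ ⟩
  (a - K) * c₀ - a * ((K * F) * (- s₀))
    ≡⟨ cong₂ (λ x y → x - a * (y * (- s₀)))
             (sym (coeff-mulLin-zero (a - K) K L)) (sym (pos-* (suc k) (k !))) ⟩
  coeff (linProd a (suc (suc k))) 0 - a * (+ (suc k !) * (- s₀)) ∎)
  (∣m∣n⇒∣m+n (∣n⇒∣m*n (a - K) (a*a∣linProd-a*k!*signedBinomial a k 0))
             (∣m⇒∣m*n (F * s₀) ∣-refl))
  where
  K = + suc k
  F = + (k !)
  L = linProd a (suc k)
  c₀ = coeff L 0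
  s₀ = signedBinomial k 0
  identity : ∀ a K F c₀ s₀ →
    (a - K) * (c₀ - a * (F * s₀)) + a * a * (F * s₀) ≡ (a - K) * c₀ - a * ((K * F) * (- s₀))
  identity = solve-∀
a*a∣linProd-a*k!*signedBinomial a (suc k) (suc i) = subst (a * a Signed.∣_) (begin
  (a - K) * (cᵢ₊₁ - a * (F * sᵢ₊₁)) + K * (cᵢ - a * (F * sᵢ)) + a * a * (F * sᵢ₊₁)
    ≡⟨ identity a K F cᵢ cᵢ₊₁ sᵢ sᵢ₊₁ ⟩
  (a - K) * cᵢ₊₁ + K * cᵢ - a * ((K * F) * (sᵢ - sᵢ₊₁))
    ≡⟨ cong₂ (λ x y → x - a * (y * (sᵢ - sᵢ₊₁)))
             (sym (coeff-mulLin-suc (a - K) K L i)) (sym (pos-* (suc k) (k !))) ⟩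
  coeff (linProd a (suc (suc k))) (suc i) - a * (+ (suc k !) * (sᵢ - sᵢ₊₁)) ∎)
  (∣m∣n⇒∣m+n (∣m∣n⇒∣m+n (∣n⇒∣m*n (a - K) (a*a∣linProd-a*k!*signedBinomial a k (suc i)))
                        (∣n⇒∣m*n K (a*a∣linProd-a*k!*signedBinomial a k i)))
             (∣m⇒∣m*n (F * sᵢ₊₁) ∣-refl))
  where
  K = + suc k
  F = + (k !)
  L = linProd a (suc k)
  cᵢ = coeff L i
  cᵢ₊₁ = coeff L (suc i)
  sᵢ = signedBinomial k i
  sᵢ₊₁ = signedBinomial k (suc i)
  identity : ∀ a K F cᵢ cᵢ₊₁ sᵢ sᵢ₊₁ →
    (a - K) * (cᵢ₊₁ - a * (F * sᵢ₊₁)) + K * (cᵢ - a * (F * sᵢ)) + a * a * (F * sᵢ₊₁) ≡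
    (a - K) * cᵢ₊₁ + K * cᵢ - a * ((K * F) * (sᵢ - sᵢ₊₁))
  identity = solve-∀

a³∣coeff-[1-x]*linProd : ∀ k p → 1 ≤ p → p ≤ k →
  (+ suc k) ^ 3 Signed.∣ coeff (mulLin (+ 1) (- + 1) (linProd (+ suc k) (suc (suc k)))) (suc p)
a³∣coeff-[1-x]*linProd k zero    ()  _
a³∣coeff-[1-x]*linProd k (suc i) _   i<k =
  subst₂ Signed._∣_ a*[a*a]≡a³ (sym coeff≡a*difference) (*-monoʳ-∣ a a*a∣difference)
  where
  a = + suc k
  F = + (k !)
  L = linProd a (suc k)
  sᵢ = signedBinomial k i
  sᵢ₊₁ = signedBinomial k (suc i)

  a*[a*a]≡a³ : a * (a * a) ≡ a ^ 3
  a*[a*a]≡a³ = cong (λ x → a * (a * x)) (sym (*-identityʳ a))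

  coeff≡a*difference : coeff (mulLin (+ 1) (- + 1) (linProd a (suc (suc k)))) (suc (suc i))
                     ≡ a * (coeff L (suc i) - coeff L i)
  coeff≡a*difference = begin
    coeff (mulLin (+ 1) (- + 1) (mulLin (a - a) a L)) (suc (suc i))
      ≡⟨ coeff-mulLin-suc (+ 1) (- + 1) (mulLin (a - a) a L) (suc i) ⟩
    + 1 * coeff (mulLin (a - a) a L) (suc (suc i)) + - + 1 * coeff (mulLin (a - a) a L) (suc i)
      ≡⟨ cong₂ (λ x y → + 1 * x + - + 1 * y)
               (coeff-mulLin-suc (a - a) a L (suc i)) (coeff-mulLin-suc (a - a) a L i) ⟩
    + 1 * ((a - a) * coeff L (suc (suc i)) + a * coeff L (suc i))
      + - + 1 * ((a - a) * coeff L (suc i) + a * coeff L i)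
      ≡⟨ identity a (coeff L (suc (suc i))) (coeff L (suc i)) (coeff L i) ⟩
    a * (coeff L (suc i) - coeff L i) ∎
    where
    identity : ∀ a x y z → + 1 * ((a - a) * x + a * y) + - + 1 * ((a - a) * y + a * z) ≡ a * (y - z)
    identity = solve-∀

  a∣k!*[sᵢ₊₁-sᵢ] : a Signed.∣ F * (sᵢ₊₁ - sᵢ)
  a∣k!*[sᵢ₊₁-sᵢ] = subst (a Signed.∣_) (identity F sᵢ sᵢ₊₁)
                         (∣m⇒∣-m ([1+k]∣k!*signedBinomial[1+k] k i i<k))
    where
    identity : ∀ F x y → - (F * (x - y)) ≡ F * (y - x)
    identity = solve-∀

  a*a∣difference : a * a Signed.∣ coeff L (suc i) - coeff L i
  a*a∣difference = subst (a * a Signed.∣_) (identity a F (coeff L (suc i)) (coeff L i) sᵢ₊₁ sᵢ)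
    (∣m∣n⇒∣m+n (∣m∣n⇒∣m-n (a*a∣linProd-a*k!*signedBinomial a k (suc i))
                          (a*a∣linProd-a*k!*signedBinomial a k i))
               (*-monoʳ-∣ a a∣k!*[sᵢ₊₁-sᵢ]))
    where
    identity : ∀ a F x y u v → (x - a * (F * u)) - (y - a * (F * v)) + a * (F * (u - v)) ≡ x - y
    identity = solve-∀

2*[3+q]≡3+[3+[q+q]] : ∀ q → 2 N.* (3 N.+ q) ≡ 3 N.+ (3 N.+ (q N.+ q))
2*[3+q]≡3+[3+[q+q]] = ℕ-Solver.solve-∀

mainTheorem6 : (n : ℕ) → 1 ≤ n → ((+ (2 N.* n) - + 3) ^ 3) ∣ v n
mainTheorem6 0 ()
mainTheorem6 1 _ = ℕ.1∣ _
mainTheorem6 2 _ = ℕ.1∣ _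
-- For m = 3 + (3 + (q + q)), the terms + m - + 3 and m ∸ 2 reduce to a and a + 1,
-- where a = 3 + (q + q).
mainTheorem6 (suc (suc (suc q))) _ =
  subst (λ m → (+ m - + 3) ^ 3
                ∣ coeff (mulLin (+ 1) (- + 1) (linProd (+ m - + 3) (m N.∸ 2))) (suc (suc q)))
        (sym (2*[3+q]≡3+[3+[q+q]] q))
        (∣⇒∣ᵤ (a³∣coeff-[1-x]*linProd (suc (suc (q N.+ q))) (suc q) (s≤s z≤n)
                                       (s≤s (ℕ.m≤n⇒m≤1+n (ℕ.m≤m+n q q)))))
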